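{- Let $m\ge2$, $n\ge1$ and \[ \mathcal T_{m,n}=\{(a_1:\cdots:a_n) : 0\le a_i\le m(n-i+1)-1\}=[0,nm-1]\times[0,(n-1)m-1]\times\cdots\times[0,m-1]. \] The map $G(m,1,n)\to\mathcal T_{m,n}$ sending each $w$ to its inversion table $Inv(w)=(inv_1(w):\cdots:inv_n(w))$ is a bijection.
   Context: Let $\varepsilon=e^{2\pi i/m}$ and $e_1,\dots,e_n$ the standard basis of $\mathbb C^n$. $G(m,1,n)$ consists of the bijections $w$ of $\{\varepsilon^k i:1\le i\le n,1\le k\le m\}$ with $w(\varepsilon^k i)=\varepsilon^k w(i)$; writing $w(j)=\varepsilon^{r_j}\beta_j$ ($\beta\in S_n$, $0\le r_j\le m-1$), $w$ acts linearly on $\mathbb C^n$ by $w(e_j)=\varepsilon^{r_j}e_{\beta_j}$. Let $\Phi=\{\varepsilon^i e_j-\varepsilon^k e_l : \varepsilon^i e_j\ne\varepsilon^k e_l,\ 0\le i,k\le m-1,\ 1\le j,l\le n\}$, $\Phi^+=\{\varepsilon^i e_j-\varepsilon^k e_j\in\Phi : 0\le i<k\le m-1\}\cup\{e_j-\varepsilon^k e_l\in\Phi: 0\le k\le m-1,\ 1\le l<j\le n\}\cup\{\varepsilon^i e_j-\varepsilon^k e_l\in\Phi: 0\le i,k\le m-1,\ k\ne 0,\ 1\le j<l\le n\}$, $\Phi^-=\Phi\setminus\Phi^+$, and for $i=1,\dots,n$, $\Delta_i=\{e_{n+1-i}-\varepsilon^k e_{n+1-i}: 0<k\le m-1\}\cup\{e_{n+1-i}-\varepsilon^k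 e_j: 0\le k\le m-1,\ j<n+1-i\}$. Define $inv_i(w)=|w(\Delta_i)\cap\Phi^-|$. -}

module Defs where

open import Data.Nat using (ℕ; zero; suc; _*_; _∸_; _<_)
open import Data.Nat.DivMod using (_mod_)
open import Data.Fin using (Fin; toℕ; opposite) renaming (zero to fzero)
open import Data.Bool using (Bool; true; false; _∧_; _∨_; not)
open import Data.Nat using (_≡ᵇ_; _<ᵇ_)
open import Data.Product using (_×_; _,_)
open import Data.List using (List; []; length; map; filterᵇ; allFin; concatMap)
open import Data.Vec using (Vec; tabulate; lookup)
open import Function.Definitions using (Bijective)
open import Relation.Binary.PropositionalEquality using (_≡_)

-- A point ε^i e_j (also: the element ε^i·j of {ε^k i}) is encoded as (i , j) : Fin m × Fin n.
-- Indices are 0-based: Fin-index j stands for the paper's j+1, exponent i for ε^i.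
Point : ℕ → ℕ → Set
Point m n = Fin m × Fin n

rot : ∀ {m} → Fin m → Fin m → Fin m
rot {zero} () i
rot {suc m} k i = (toℕ k Data.Nat.+ toℕ i) mod suc m

act : ∀ {m n} → Fin m → Point m n → Point m n
act k (i , j) = (rot k i , j)

record G (m n : ℕ) : Set where
  field
    fun   : Point m n → Point m n
    bij   : Bijective _≡_ _≡_ fun
    equiv : ∀ (k : Fin m) (x : Point m n) → fun (act k x) ≡ act k (fun x)
open G public

-- A root ε^i e_j - ε^k e_l is encoded formally as the ordered pair of points
-- ((i , j) , (k , l)).
Root : ℕ → ℕ → Set
Root m n = Point m n × Point m n

isZero : ∀ {m} → Fin m → Bool
isZero k = toℕ k ≡ᵇ 0

-- membership in Φ⁺ (for distinct points)
isPos : ∀ {m n} → Root m n → Bool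
isPos ((i , j) , (k , l)) =
  ((toℕ j ≡ᵇ toℕ l) ∧ (toℕ i <ᵇ toℕ k))
  ∨ ((toℕ l <ᵇ toℕ j) ∧ isZero i)
  ∨ ((toℕ j <ᵇ toℕ l) ∧ not (isZero k))

isNeg : ∀ {m n} → Root m n → Bool
isNeg r = not (isPos r)

-- Δ for the point index p (0-based p stands for the paper's n+1-i):
-- {e_p - ε^k e_p : 0<k} ∪ {e_p - ε^k e_j : j < p, any k}
Δ : ∀ {m n} → Fin n → List (Root m n)
Δ {zero} p = []
Δ {suc m} {n} p =
  map (λ k → ((fzero , p) , (k , p))) (filterᵇ (λ k → not (isZero k)) (allFin (suc m)))
  Data.List.++
  concatMap (λ j → map (λ k → ((fzero , p) , (k , j))) (allFin (suc m)))
            (filterᵇ (λ j → toℕ j <ᵇ toℕ p) (allFin n))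

actRoot : ∀ {m n} → G m n → Root m n → Root m n
actRoot w (a , b) = (fun w a , fun w b)

-- inv_i(w) = |w(Δ_i) ∩ Φ⁻|, with 0-based i; Δ_i uses the point index n+1-i,
-- i.e. 0-based opposite i.
inv : ∀ {m n} → Fin n → G m n → ℕ
inv i w = length (filterᵇ isNeg (map (actRoot w) (Δ (opposite i))))

Inv : ∀ {m n} → G m n → Vec ℕ n
Inv w = tabulate (λ i → inv i w)

-- membership in T_{m,n}: 0 ≤ a_i ≤ m(n-i+1)-1 (1-based), i.e. a_i < m(n - i) for 0-based i
InT : (m n : ℕ) → Vec ℕ n → Set
InT m n a = ∀ (i : Fin n) → lookup a i < m * (n ∸ toℕ i)

-- An element w of G(m,1,n) is determined by its colours and its underlying permutation:
-- w(e_j) = ε^(r_j) e_(β_j). Counting the negative roots in w(Δ) for the index p (0-based) gives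
--   inv = r_p + [r_p ≠ 0]·m·S_p + (p − S_p),   S_p = #{j < p : β_j < β_p}:
-- the roots e_p − ε^k e_p contribute r_p, and a root e_p − ε^k e_j with j < p is negative for all m
-- values of k or for none (according to r_p) when β_j < β_p, and for exactly one k otherwise.
-- The map (r, S) ↦ r + [r ≠ 0]·m·S + (p − S) is a bijection [0,m) × [0,p] → [0, m(p+1)), and
-- S is the Lehmer code of β, which determines β and takes every value with S_p ≤ p.
module Submission where

open import Defs
open import Data.Bool using (Bool; true; false; not; if_then_else_)
open import Data.Bool.Properties using (T-≡; ∨-identityʳ; not-involutive)
open import Data.Empty using (⊥-elim)
open import Data.Fin using (Fin; toℕ; fromℕ<; opposite) renaming (zero to fzero; suc to fsuc)
open import Data.Fin.Properties using (toℕ-injective; toℕ<n; toℕ-fromℕ<; fromℕ<-toℕ; opposite-prop; opposite-involutive)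
open import Data.List using (List; []; _∷_; _++_; length; map; filterᵇ; concatMap; tabulate; allFin)
open import Data.Nat
open import Data.Nat.DivMod using (_%_; _/_; _mod_; m%n<n; m<n⇒m%n≡m; m≡m%n+[m/n]*n; m<n*o⇒m/o<n; %-distribˡ-+; m%n%n≡m%n; [m+n]%n≡m%n; [m+kn]%n≡m%n; m≤n⇒[n∸m]%m≡n%m)
open import Data.Nat.Properties
open import Data.Nat.Tactic.RingSolver using (solve-∀)
open import Data.Product using (Σ; ∃-syntax; _×_; _,_; proj₁; proj₂)
open import Data.Sum using (inj₁; inj₂)
open import Data.Vec using (Vec; lookup)
open import Data.Vec.Properties using (lookup∘tabulate; tabulate-cong; tabulate∘lookup)
open import Function using (_∘_; const)
open import Function.Bundles using (Equivalence)
open import Relation.Binary using (tri<; tri≈; tri>)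
open import Relation.Binary.PropositionalEquality
open import Relation.Nullary using (¬_; yes; no)
open import Relation.Nullary.Decidable using (dec-true; dec-false)

<ᵇ-true : ∀ {m n} → m < n → (m <ᵇ n) ≡ true
<ᵇ-true {m} {n} = dec-true (m <? n)

<ᵇ-false : ∀ {m n} → ¬ m < n → (m <ᵇ n) ≡ false
<ᵇ-false {m} {n} = dec-false (m <? n)

≡ᵇ-true : ∀ {m n} → m ≡ n → (m ≡ᵇ n) ≡ true
≡ᵇ-true {m} {n} = dec-true (m ≟ n)

≡ᵇ-false : ∀ {m n} → m ≢ n → (m ≡ᵇ n) ≡ false
≡ᵇ-false {m} {n} = dec-false (m ≟ n)

≡ᵇ-cong-⇔ : ∀ {a b c d} → (a ≡ b → c ≡ d) → (c ≡ d → a ≡ b) → (a ≡ᵇ b) ≡ (c ≡ᵇ d)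
≡ᵇ-cong-⇔ {a} {b} to from with a ≟ b
... | yes a≡b = trans (≡ᵇ-true a≡b) (sym (≡ᵇ-true (to a≡b)))
... | no  a≢b = trans (≡ᵇ-false a≢b) (sym (≡ᵇ-false (a≢b ∘ from)))

<ᵇ≡true⇒< : ∀ {m n} → (m <ᵇ n) ≡ true → m < n
<ᵇ≡true⇒< {m} {n} eq = <ᵇ⇒< m n (Equivalence.from T-≡ eq)

fromBool : Bool → ℕ
fromBool true  = 1
fromBool false = 0

fromBool-<ᵇ-suc : ∀ x y → fromBool (x <ᵇ suc y) ≡ fromBool (x <ᵇ y) + fromBool (x ≡ᵇ y)
fromBool-<ᵇ-suc zero    zero    = refl
fromBool-<ᵇ-suc zero    (suc y) = refl
fromBool-<ᵇ-suc (suc x) zero    = refl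
fromBool-<ᵇ-suc (suc x) (suc y) = fromBool-<ᵇ-suc x y

sumBelow : ℕ → (ℕ → ℕ) → ℕ
sumBelow zero    f = 0
sumBelow (suc n) f = sumBelow n f + f n

count : ℕ → (ℕ → Bool) → ℕ
count n P = sumBelow n (fromBool ∘ P)

sumBelow-cong : ∀ n {f g : ℕ → ℕ} → (∀ j → j < n → f j ≡ g j) → sumBelow n f ≡ sumBelow n g
sumBelow-cong zero    f≗g = refl
sumBelow-cong (suc n) f≗g = cong₂ _+_ (sumBelow-cong n (λ j j<n → f≗g j (m<n⇒m<1+n j<n))) (f≗g n ≤-refl)

sumBelow-const : ∀ n c → sumBelow n (const c) ≡ n * c
sumBelow-const zero    c = refl
sumBelow-const (suc n) c = trans (cong (_+ c) (sumBelow-const n c)) (+-comm (n * c) c)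

sumBelow-suc : ∀ n (g : ℕ → ℕ) → sumBelow (suc n) g ≡ g 0 + sumBelow n (g ∘ suc)
sumBelow-suc zero    g = +-comm 0 (g 0)
sumBelow-suc (suc n) g = trans (cong (_+ g (suc n)) (sumBelow-suc n g)) (+-assoc (g 0) _ _)

sumBelow-+ : ∀ n (f g : ℕ → ℕ) → sumBelow n (λ j → f j + g j) ≡ sumBelow n f + sumBelow n g
sumBelow-+ zero    f g = refl
sumBelow-+ (suc n) f g rewrite sumBelow-+ n f g = interchange (sumBelow n f) (sumBelow n g) (f n) (g n)
  where
  interchange : ∀ a b c d → a + b + (c + d) ≡ a + c + (b + d)
  interchange = solve-∀

sumBelow-* : ∀ n a (f : ℕ → ℕ) → sumBelow n (λ j → a * f j) ≡ a * sumBelow n f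
sumBelow-* zero    a f = sym (*-zeroʳ a)
sumBelow-* (suc n) a f = trans (cong (_+ a * f n) (sumBelow-* n a f)) (sym (*-distribˡ-+ a (sumBelow n f) (f n)))

sumBelow-truncate : ∀ {t n} (f : ℕ → ℕ) → t ≤ n → sumBelow n (λ q → if q <ᵇ t then f q else 0) ≡ sumBelow t f
sumBelow-truncate {t} {zero}  f z≤n = refl
sumBelow-truncate {t} {suc n} f t≤1+n with m≤n⇒m<n∨m≡n t≤1+n
... | inj₁ t<1+n rewrite <ᵇ-false (≤⇒≯ (s≤s⁻¹ t<1+n)) = trans (+-identityʳ _) (sumBelow-truncate f (s≤s⁻¹ t<1+n))
... | inj₂ refl = sumBelow-cong (suc n) (λ q q<t → cong (if_then f q else 0) (<ᵇ-true q<t))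

count-none : ∀ n {P : ℕ → Bool} → (∀ j → j < n → P j ≡ false) → count n P ≡ 0
count-none n none = trans (sumBelow-cong n (λ j j<n → cong fromBool (none j j<n))) (trans (sumBelow-const n 0) (*-zeroʳ n))

count-≡ᵇ : ∀ {n x} → x < n → count n (_≡ᵇ x) ≡ 1
count-≡ᵇ {suc n} {x} x<1+n with x ≟ n
... | yes refl = cong₂ _+_ (count-none n (λ j j<n → ≡ᵇ-false (<⇒≢ j<n))) (cong fromBool (≡ᵇ-true {n} refl))
... | no x≢n = cong₂ _+_ (count-≡ᵇ (≤∧≢⇒< (s≤s⁻¹ x<1+n) x≢n)) (cong fromBool (≡ᵇ-false (x≢n ∘ sym)))

count-complement : ∀ n (P : ℕ → Bool) → count n P + count n (not ∘ P) ≡ n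
count-complement n P = begin
  count n P + count n (not ∘ P)                             ≡⟨ sumBelow-+ n (fromBool ∘ P) (fromBool ∘ not ∘ P) ⟨
  sumBelow n (λ j → fromBool (P j) + fromBool (not (P j)))  ≡⟨ sumBelow-cong n (λ j _ → one (P j)) ⟩
  sumBelow n (const 1)                                      ≡⟨ sumBelow-const n 1 ⟩
  n * 1                                                     ≡⟨ *-identityʳ n ⟩
  n                                                         ∎
  where
  open ≡-Reasoning
  one : ∀ b → fromBool b + fromBool (not b) ≡ 1
  one true  = refl
  one false = refl

count-≤ : ∀ n (P : ℕ → Bool) → count n P ≤ n
count-≤ n P = subst (count n P ≤_) (count-complement n P) (m≤m+n _ _)

count-not : ∀ n (P : ℕ → Bool) → count n (not ∘ P) ≡ n ∸ count n P
count-not n P = trans (sym (m+n∸m≡n (count n P) _)) (cong (_∸ count n P) (count-complement n P))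

sumBelow-if : ∀ n (P : ℕ → Bool) a → sumBelow n (λ j → if P j then a else 1) ≡ a * count n P + (n ∸ count n P)
sumBelow-if n P a = begin
  sumBelow n (λ j → if P j then a else 1)                              ≡⟨ sumBelow-cong n (λ j _ → split (P j)) ⟩
  sumBelow n (λ j → a * fromBool (P j) + fromBool (not (P j)))          ≡⟨ sumBelow-+ n _ _ ⟩
  sumBelow n (λ j → a * fromBool (P j)) + count n (not ∘ P)            ≡⟨ cong₂ _+_ (sumBelow-* n a _) (count-not n P) ⟩
  a * count n P + (n ∸ count n P)                                      ∎
  where
  open ≡-Reasoning
  split : ∀ b → (if b then a else 1) ≡ a * fromBool b + fromBool (not b)
  split true  = sym (trans (+-identityʳ _) (*-identityʳ a))
  split false = cong (_+ 1) (sym (*-zeroʳ a))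

-- Sums over lists
private
  variable
    A B : Set

sumMap : (A → ℕ) → List A → ℕ
sumMap h []       = 0
sumMap h (x ∷ xs) = h x + sumMap h xs

length-filterᵇ : ∀ (P : A → Bool) xs → length (filterᵇ P xs) ≡ sumMap (fromBool ∘ P) xs
length-filterᵇ P []       = refl
length-filterᵇ P (x ∷ xs) with P x
... | true  = cong suc (length-filterᵇ P xs)
... | false = length-filterᵇ P xs

sumMap-map : ∀ (h : B → ℕ) (f : A → B) xs → sumMap h (map f xs) ≡ sumMap (h ∘ f) xs
sumMap-map h f []       = refl
sumMap-map h f (x ∷ xs) = cong (h (f x) +_) (sumMap-map h f xs)

sumMap-++ : ∀ (h : A → ℕ) xs ys → sumMap h (xs ++ ys) ≡ sumMap h xs + sumMap h ys
sumMap-++ h []       ys = refl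
sumMap-++ h (x ∷ xs) ys = trans (cong (h x +_) (sumMap-++ h xs ys)) (sym (+-assoc (h x) _ _))

sumMap-concatMap : ∀ (h : B → ℕ) (f : A → List B) xs → sumMap h (concatMap f xs) ≡ sumMap (sumMap h ∘ f) xs
sumMap-concatMap h f []       = refl
sumMap-concatMap h f (x ∷ xs) = trans (sumMap-++ h (f x) _) (cong (sumMap h (f x) +_) (sumMap-concatMap h f xs))

sumMap-filterᵇ : ∀ (h : A → ℕ) (P : A → Bool) xs → sumMap h (filterᵇ P xs) ≡ sumMap (λ x → if P x then h x else 0) xs
sumMap-filterᵇ h P []       = refl
sumMap-filterᵇ h P (x ∷ xs) with P x
... | true  = cong (h x +_) (sumMap-filterᵇ h P xs)
... | false = sumMap-filterᵇ h P xs

sumMap-tabulate : ∀ n (f : Fin n → A) (h : A → ℕ) (g : ℕ → ℕ) →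
                  (∀ i → h (f i) ≡ g (toℕ i)) → sumMap h (tabulate f) ≡ sumBelow n g
sumMap-tabulate zero    f h g hf≗g = refl
sumMap-tabulate (suc n) f h g hf≗g =
  trans (cong₂ _+_ (hf≗g fzero) (sumMap-tabulate n (f ∘ fsuc) h (g ∘ suc) (hf≗g ∘ fsuc))) (sym (sumBelow-suc n g))

sumMap-filterᵇ-allFin : ∀ n (P : Fin n → Bool) (h : Fin n → ℕ) (g : ℕ → ℕ) →
                        (∀ i → P i ≡ true → h i ≡ g (toℕ i)) → (∀ i → P i ≡ false → g (toℕ i) ≡ 0) →
                        sumMap h (filterᵇ P (allFin n)) ≡ sumBelow n g
sumMap-filterᵇ-allFin n P h g kept dropped =
  trans (sumMap-filterᵇ h P (allFin n)) (sumMap-tabulate n (λ i → i) (λ i → if P i then h i else 0) g pointwise)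
  where
  pointwise : ∀ i → (if P i then h i else 0) ≡ g (toℕ i)
  pointwise i with P i in eq
  ... | true  = kept i eq
  ... | false = sym (dropped i eq)

-- Permutations of [0, n) and Lehmer codes
record IsPermutation (n : ℕ) (β : ℕ → ℕ) : Set where
  field
    bounded    : ∀ {j} → j < n → β j < n
    injective  : ∀ {i j} → i < n → j < n → β i ≡ β j → i ≡ j
    surjective : ∀ {y} → y < n → ∃[ j ] j < n × β j ≡ y
open IsPermutation

id-isPermutation : ∀ {n} → IsPermutation n (λ j → j)
id-isPermutation = record { bounded = λ j<n → j<n ; injective = λ _ _ eq → eq ; surjective = λ {y} y<n → y , y<n , refl }

count-<ᵇ-permutation : ∀ {n β} → IsPermutation n β → ∀ {y} → y ≤ n → count n (λ j → β j <ᵇ y) ≡ y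
count-<ᵇ-permutation {n} {β} π {zero}  _     = count-none n (λ j _ → <ᵇ-false {β j} {0} λ ())
count-<ᵇ-permutation {n} {β} π {suc y} y<n = begin
  count n (λ j → β j <ᵇ suc y)                                  ≡⟨ sumBelow-cong n (λ j _ → fromBool-<ᵇ-suc (β j) y) ⟩
  sumBelow n (λ j → fromBool (β j <ᵇ y) + fromBool (β j ≡ᵇ y))  ≡⟨ sumBelow-+ n _ _ ⟩
  count n (λ j → β j <ᵇ y) + count n (λ j → β j ≡ᵇ y)           ≡⟨ cong₂ _+_ (count-<ᵇ-permutation π (<⇒≤ y<n)) hit-once ⟩
  y + 1                                                         ≡⟨ +-comm y 1 ⟩
  suc y                                                         ∎
  where
  open ≡-Reasoning
  source = surjective π y<n
  x = proj₁ source
  x<n = proj₁ (proj₂ source)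
  βx≡y = proj₂ (proj₂ source)
  hit-once : count n (λ j → β j ≡ᵇ y) ≡ 1
  hit-once = trans (sumBelow-cong n (λ j j<n → cong fromBool (≡ᵇ-cong-⇔
                      (λ βj≡y → injective π j<n x<n (trans βj≡y (sym βx≡y)))
                      (λ j≡x → trans (cong β j≡x) βx≡y))))
                   (count-≡ᵇ x<n)

punchIn : ℕ → ℕ → ℕ
punchIn c x = if x <ᵇ c then x else suc x

punchOut : ℕ → ℕ → ℕ
punchOut c x = if c <ᵇ x then pred x else x

punchIn-< : ∀ {c x} → x < c → punchIn c x ≡ x
punchIn-< x<c rewrite <ᵇ-true x<c = refl

punchIn-≥ : ∀ {c x} → c ≤ x → punchIn c x ≡ suc x
punchIn-≥ c≤x rewrite <ᵇ-false (≤⇒≯ c≤x) = refl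

punchIn-<ᵇ : ∀ c x y → (punchIn c x <ᵇ punchIn c y) ≡ (x <ᵇ y)
punchIn-<ᵇ c x y with x <? c | y <? c
... | yes x<c | yes y<c rewrite punchIn-< x<c | punchIn-< y<c = refl
... | yes x<c | no  y≮c rewrite punchIn-< x<c | punchIn-≥ (≮⇒≥ y≮c) =
  trans (<ᵇ-true (m<n⇒m<1+n x<y)) (sym (<ᵇ-true x<y))
  where x<y = <-≤-trans x<c (≮⇒≥ y≮c)
... | no  x≮c | yes y<c rewrite punchIn-≥ (≮⇒≥ x≮c) | punchIn-< y<c =
  trans (<ᵇ-false (λ x<y → x≮c (<-trans (n<1+n x) (<-trans x<y y<c)))) (sym (<ᵇ-false (λ x<y → x≮c (<-trans x<y y<c))))
... | no  x≮c | no  y≮c rewrite punchIn-≥ (≮⇒≥ x≮c) | punchIn-≥ (≮⇒≥ y≮c) = refl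

punchIn-<ᵇ-pivot : ∀ c x → (punchIn c x <ᵇ c) ≡ (x <ᵇ c)
punchIn-<ᵇ-pivot c x with x <? c
... | yes x<c rewrite punchIn-< x<c = refl
... | no  x≮c rewrite punchIn-≥ (≮⇒≥ x≮c) = trans (<ᵇ-false (λ x<c → x≮c (<-trans (n<1+n x) x<c))) (sym (<ᵇ-false x≮c))

punchIn≢pivot : ∀ c x → punchIn c x ≢ c
punchIn≢pivot c x with x <? c
... | yes x<c rewrite punchIn-< x<c = <⇒≢ x<c
... | no  x≮c rewrite punchIn-≥ (≮⇒≥ x≮c) = ≢-sym (<⇒≢ (s≤s (≮⇒≥ x≮c)))

punchIn-injective : ∀ c {x y} → punchIn c x ≡ punchIn c y → x ≡ y
punchIn-injective c {x} {y} eq with x <? c | y <? c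
... | yes x<c | yes y<c rewrite punchIn-< x<c | punchIn-< y<c = eq
... | yes x<c | no  y≮c rewrite punchIn-< x<c | punchIn-≥ (≮⇒≥ y≮c) =
  ⊥-elim (<-irrefl eq (<-≤-trans x<c (≤-trans (≮⇒≥ y≮c) (n≤1+n y))))
... | no  x≮c | yes y<c rewrite punchIn-≥ (≮⇒≥ x≮c) | punchIn-< y<c =
  ⊥-elim (<-irrefl (sym eq) (<-≤-trans y<c (≤-trans (≮⇒≥ x≮c) (n≤1+n x))))
... | no  x≮c | no  y≮c rewrite punchIn-≥ (≮⇒≥ x≮c) | punchIn-≥ (≮⇒≥ y≮c) = suc-injective eq

punchIn-bounded : ∀ {c x n} → c ≤ n → x < n → punchIn c x < suc n
punchIn-bounded {c} {x} c≤n x<n with x <? c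
... | yes x<c rewrite punchIn-< x<c = m<n⇒m<1+n x<n
... | no  x≮c rewrite punchIn-≥ (≮⇒≥ x≮c) = s≤s x<n

punchIn-punchOut : ∀ {c x} → x ≢ c → punchIn c (punchOut c x) ≡ x
punchIn-punchOut {c} {x} x≢c with c <? x
punchIn-punchOut {c} {suc x} x≢c | yes c<x rewrite <ᵇ-true c<x = punchIn-≥ (s≤s⁻¹ c<x)
... | no c≮x rewrite <ᵇ-false c≮x = punchIn-< (≤∧≢⇒< (≮⇒≥ c≮x) x≢c)

punchOut-punchIn : ∀ c y → punchOut c (punchIn c y) ≡ y
punchOut-punchIn c y with y <? c
... | yes y<c rewrite punchIn-< y<c | <ᵇ-false (<⇒≯ y<c) = refl
... | no  y≮c rewrite punchIn-≥ (≮⇒≥ y≮c) | <ᵇ-true (s≤s (≮⇒≥ y≮c)) = refl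

punchOut-bounded : ∀ {c x n} → c < suc n → x < suc n → x ≢ c → punchOut c x < n
punchOut-bounded {c} {x} c<1+n x<1+n x≢c with c <? x
punchOut-bounded {c} {suc x} c<1+n x<1+n x≢c | yes c<x rewrite <ᵇ-true c<x = s≤s⁻¹ x<1+n
... | no c≮x rewrite <ᵇ-false c≮x = <-≤-trans (≤∧≢⇒< (≮⇒≥ c≮x) x≢c) (s≤s⁻¹ c<1+n)

lehmerCode : (ℕ → ℕ) → ℕ → ℕ
lehmerCode β p = count p (λ j → β j <ᵇ β p)

lehmerCode-≤ : ∀ β p → lehmerCode β p ≤ p
lehmerCode-≤ β p = count-≤ p (λ j → β j <ᵇ β p)

lehmerCode-cong : ∀ {β β′} p → (∀ q → q ≤ p → β q ≡ β′ q) → lehmerCode β p ≡ lehmerCode β′ p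
lehmerCode-cong p β≗β′ = sumBelow-cong p (λ q q<p → cong fromBool (cong₂ _<ᵇ_ (β≗β′ q (<⇒≤ q<p)) (β≗β′ p ≤-refl)))

lehmerCode-punchIn : ∀ c (δ : ℕ → ℕ) p → lehmerCode (punchIn c ∘ δ) p ≡ lehmerCode δ p
lehmerCode-punchIn c δ p = sumBelow-cong p (λ j _ → cong fromBool (punchIn-<ᵇ c (δ j) (δ p)))

count-punchIn-<ᵇ-pivot : ∀ c (δ : ℕ → ℕ) p → count p (λ j → punchIn c (δ j) <ᵇ c) ≡ count p (λ j → δ j <ᵇ c)
count-punchIn-<ᵇ-pivot c δ p = sumBelow-cong p (λ j _ → cong fromBool (punchIn-<ᵇ-pivot c (δ j)))

-- Decoding from the right: β (n − 1) = c (n − 1) is the rank of the last value, and the values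
-- decoded for [0, n − 1) are shifted past it.
fromLehmerCode : (ℕ → ℕ) → ℕ → ℕ → ℕ
fromLehmerCode c zero    j = 0
fromLehmerCode c (suc n) j = if j <ᵇ n then punchIn (c n) (fromLehmerCode c n j) else c n

fromLehmerCode-< : ∀ c {n j} → j < n → fromLehmerCode c (suc n) j ≡ punchIn (c n) (fromLehmerCode c n j)
fromLehmerCode-< c j<n rewrite <ᵇ-true j<n = refl

fromLehmerCode-last : ∀ c n → fromLehmerCode c (suc n) n ≡ c n
fromLehmerCode-last c n rewrite <ᵇ-false (<-irrefl {n} refl) = refl

fromLehmerCode-cong : ∀ n {c c′} → (∀ p → p < n → c p ≡ c′ p) → ∀ j → fromLehmerCode c n j ≡ fromLehmerCode c′ n j
fromLehmerCode-cong zero    c≗c′ j = refl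
fromLehmerCode-cong (suc n) c≗c′ j =
  cong₂ (λ a b → if j <ᵇ n then punchIn a b else a) (c≗c′ n ≤-refl) (fromLehmerCode-cong n (λ p p<n → c≗c′ p (m<n⇒m<1+n p<n)) j)

IsLehmerCode : ℕ → (ℕ → ℕ) → Set
IsLehmerCode n c = ∀ p → p < n → c p ≤ p

IsLehmerCode-pred : ∀ {n c} → IsLehmerCode (suc n) c → IsLehmerCode n c
IsLehmerCode-pred code p p<n = code p (m<n⇒m<1+n p<n)

fromLehmerCode-isPermutation : ∀ n {c} → IsLehmerCode n c → IsPermutation n (fromLehmerCode c n)
fromLehmerCode-isPermutation zero    code = record { bounded = λ () ; injective = λ () ; surjective = λ () }
fromLehmerCode-isPermutation (suc n) {c} code = record { bounded = bd ; injective = inj ; surjective = surj }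
  where
  π = fromLehmerCode-isPermutation n (IsLehmerCode-pred code)
  cₙ≤n = code n ≤-refl
  bd : ∀ {j} → j < suc n → fromLehmerCode c (suc n) j < suc n
  bd {j} j<1+n with m<1+n⇒m<n∨m≡n j<1+n
  ... | inj₁ j<n  rewrite fromLehmerCode-< c j<n = punchIn-bounded cₙ≤n (bounded π j<n)
  ... | inj₂ refl rewrite fromLehmerCode-last c n = s≤s cₙ≤n
  inj : ∀ {i j} → i < suc n → j < suc n → fromLehmerCode c (suc n) i ≡ fromLehmerCode c (suc n) j → i ≡ j
  inj i<1+n j<1+n eq with m<1+n⇒m<n∨m≡n i<1+n | m<1+n⇒m<n∨m≡n j<1+n
  ... | inj₁ i<n  | inj₁ j<n  rewrite fromLehmerCode-< c i<n | fromLehmerCode-< c j<n =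
    injective π i<n j<n (punchIn-injective (c n) eq)
  ... | inj₁ i<n  | inj₂ refl rewrite fromLehmerCode-< c i<n | fromLehmerCode-last c n = ⊥-elim (punchIn≢pivot (c n) _ eq)
  ... | inj₂ refl | inj₁ j<n  rewrite fromLehmerCode-< c j<n | fromLehmerCode-last c n = ⊥-elim (punchIn≢pivot (c n) _ (sym eq))
  ... | inj₂ refl | inj₂ refl = refl
  surj : ∀ {y} → y < suc n → ∃[ j ] j < suc n × fromLehmerCode c (suc n) j ≡ y
  surj {y} y<1+n with y ≟ c n
  ... | yes refl = n , ≤-refl , fromLehmerCode-last c n
  ... | no  y≢cₙ with surjective π (punchOut-bounded (s≤s cₙ≤n) y<1+n y≢cₙ)
  ... | j , j<n , eq = j , m<n⇒m<1+n j<n ,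
    trans (fromLehmerCode-< c j<n) (trans (cong (punchIn (c n)) eq) (punchIn-punchOut y≢cₙ))

lehmerCode-fromLehmerCode : ∀ n {c} → IsLehmerCode n c → ∀ p → p < n → lehmerCode (fromLehmerCode c n) p ≡ c p
lehmerCode-fromLehmerCode (suc n) {c} code p p<1+n with m<1+n⇒m<n∨m≡n p<1+n
... | inj₁ p<n = begin
  lehmerCode (fromLehmerCode c (suc n)) p                ≡⟨ lehmerCode-cong p (λ q q≤p → fromLehmerCode-< c (≤-<-trans q≤p p<n)) ⟩
  lehmerCode (punchIn (c n) ∘ fromLehmerCode c n) p      ≡⟨ lehmerCode-punchIn (c n) (fromLehmerCode c n) p ⟩
  lehmerCode (fromLehmerCode c n) p                      ≡⟨ lehmerCode-fromLehmerCode n (IsLehmerCode-pred code) p p<n ⟩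
  c p                                                    ∎
  where open ≡-Reasoning
... | inj₂ refl = begin
  lehmerCode (fromLehmerCode c (suc p)) p                ≡⟨ sumBelow-cong p (λ j j<p → cong fromBool
                                                              (cong₂ _<ᵇ_ (fromLehmerCode-< c j<p) (fromLehmerCode-last c p))) ⟩
  count p (λ j → punchIn (c p) (fromLehmerCode c p j) <ᵇ c p) ≡⟨ count-punchIn-<ᵇ-pivot (c p) (fromLehmerCode c p) p ⟩
  count p (λ j → fromLehmerCode c p j <ᵇ c p)            ≡⟨ count-<ᵇ-permutation (fromLehmerCode-isPermutation p (IsLehmerCode-pred code)) (code p ≤-refl) ⟩
  c p                                                    ∎
  where open ≡-Reasoning

module _ {n β} (π : IsPermutation (suc n) β) where

  private
    βj≢βn : ∀ {j} → j < n → β j ≢ β n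
    βj≢βn j<n eq = <⇒≢ j<n (injective π (m<n⇒m<1+n j<n) ≤-refl eq)

  punchOut-last : ℕ → ℕ
  punchOut-last j = punchOut (β n) (β j)

  punchIn-punchOut-last : ∀ {j} → j < n → punchIn (β n) (punchOut-last j) ≡ β j
  punchIn-punchOut-last j<n = punchIn-punchOut (βj≢βn j<n)

  punchOut-last-isPermutation : IsPermutation n punchOut-last
  punchOut-last-isPermutation = record { bounded = bd ; injective = inj ; surjective = surj }
    where
    bd : ∀ {j} → j < n → punchOut-last j < n
    bd j<n = punchOut-bounded (bounded π ≤-refl) (bounded π (m<n⇒m<1+n j<n)) (βj≢βn j<n)
    inj : ∀ {i j} → i < n → j < n → punchOut-last i ≡ punchOut-last j → i ≡ j
    inj i<n j<n eq = injective π (m<n⇒m<1+n i<n) (m<n⇒m<1+n j<n)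
      (trans (sym (punchIn-punchOut-last i<n)) (trans (cong (punchIn (β n)) eq) (punchIn-punchOut-last j<n)))
    surj : ∀ {y} → y < n → ∃[ j ] j < n × punchOut-last j ≡ y
    surj {y} y<n with surjective π (punchIn-bounded (s≤s⁻¹ (bounded π ≤-refl)) y<n)
    ... | j , j<1+n , eq with m<1+n⇒m<n∨m≡n j<1+n
    ... | inj₁ j<n  = j , j<n , trans (cong (punchOut (β n)) eq) (punchOut-punchIn (β n) y)
    ... | inj₂ refl = ⊥-elim (punchIn≢pivot (β n) y (sym eq))

  lehmerCode-punchOut-last : ∀ {p} → p < n → lehmerCode β p ≡ lehmerCode punchOut-last p
  lehmerCode-punchOut-last {p} p<n = begin
    lehmerCode β p                                ≡⟨ lehmerCode-cong p (λ q q≤p → punchIn-punchOut-last (≤-<-trans q≤p p<n)) ⟨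
    lehmerCode (punchIn (β n) ∘ punchOut-last) p  ≡⟨ lehmerCode-punchIn (β n) punchOut-last p ⟩
    lehmerCode punchOut-last p                    ∎
    where open ≡-Reasoning

  lehmerCode-last : lehmerCode β n ≡ β n
  lehmerCode-last = begin
    lehmerCode β n                                          ≡⟨ sumBelow-cong n (λ j j<n → cong (λ b → fromBool (b <ᵇ β n)) (punchIn-punchOut-last j<n)) ⟨
    count n (λ j → punchIn (β n) (punchOut-last j) <ᵇ β n)  ≡⟨ count-punchIn-<ᵇ-pivot (β n) punchOut-last n ⟩
    count n (λ j → punchOut-last j <ᵇ β n)                  ≡⟨ count-<ᵇ-permutation punchOut-last-isPermutation (s≤s⁻¹ (bounded π ≤-refl)) ⟩
    β n                                                     ∎
    where open ≡-Reasoning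

fromLehmerCode-lehmerCode : ∀ n {β} → IsPermutation n β → ∀ j → j < n → fromLehmerCode (lehmerCode β) n j ≡ β j
fromLehmerCode-lehmerCode (suc n) {β} π j j<1+n with m<1+n⇒m<n∨m≡n j<1+n
... | inj₁ j<n = begin
  fromLehmerCode (lehmerCode β) (suc n) j                        ≡⟨ fromLehmerCode-< (lehmerCode β) j<n ⟩
  punchIn (lehmerCode β n) (fromLehmerCode (lehmerCode β) n j)   ≡⟨ cong₂ punchIn (lehmerCode-last π) (fromLehmerCode-cong n (λ p → lehmerCode-punchOut-last π) j) ⟩
  punchIn (β n) (fromLehmerCode (lehmerCode β′) n j)             ≡⟨ cong (punchIn (β n)) (fromLehmerCode-lehmerCode n (punchOut-last-isPermutation π) j j<n) ⟩
  punchIn (β n) (β′ j)                                           ≡⟨ punchIn-punchOut-last π j<n ⟩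
  β j                                                            ∎
  where
  open ≡-Reasoning
  β′ = punchOut-last π
... | inj₂ refl = trans (fromLehmerCode-last (lehmerCode β) n) (lehmerCode-last π)

lehmerCode-injective : ∀ n {β β′} → IsPermutation n β → IsPermutation n β′ →
                       (∀ p → p < n → lehmerCode β p ≡ lehmerCode β′ p) → ∀ j → j < n → β j ≡ β′ j
lehmerCode-injective n {β} {β′} π π′ same j j<n = begin
  β j                                ≡⟨ fromLehmerCode-lehmerCode n π j j<n ⟨
  fromLehmerCode (lehmerCode β) n j  ≡⟨ fromLehmerCode-cong n same j ⟩
  fromLehmerCode (lehmerCode β′) n j ≡⟨ fromLehmerCode-lehmerCode n π′ j j<n ⟩
  β′ j                               ∎
  where open ≡-Reasoning

-- Entries of the inversion table
colourWeight : ℕ → ℕ → ℕ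
colourWeight m zero    = 0
colourWeight m (suc _) = m

colourWeight-fromBool : ∀ m r → m * fromBool (not (r ≡ᵇ 0)) ≡ colourWeight m r
colourWeight-fromBool m zero    = *-zeroʳ m
colourWeight-fromBool m (suc r) = *-identityʳ m

tableEntry : ℕ → ℕ → ℕ → ℕ → ℕ
tableEntry m r S P = r + (colourWeight m r * S + (P ∸ S))

tableEntry-suc : ∀ K u {S P} → S ≤ P → tableEntry (suc K) (suc u) S P ≡ suc (u + S * K + P)
tableEntry-suc K u {S} S≤P =
  subst (λ P → tableEntry (suc K) (suc u) S P ≡ suc (u + S * K + P)) (m+[n∸m]≡n S≤P) (shifted (_ ∸ S))
  where
  identity : ∀ K u S T → suc u + (suc K * S + T) ≡ suc (u + S * K + (S + T))
  identity = solve-∀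
  shifted : ∀ T → tableEntry (suc K) (suc u) S (S + T) ≡ suc (u + S * K + (S + T))
  shifted T rewrite m+n∸m≡n S T = identity K u S T

tableEntry-< : ∀ {m r S P} → r < m → S ≤ P → tableEntry m r S P < m * suc P
tableEntry-< {suc K} {zero}  {S} {P} _   _   = <-≤-trans (s≤s (m∸n≤m P S)) (m≤m+n (suc P) (K * suc P))
tableEntry-< {suc K} {suc u} {S} {P} r<m S≤P = begin-strict
  tableEntry (suc K) (suc u) S P ≡⟨ tableEntry-suc K u S≤P ⟩
  suc (u + S * K + P)           <⟨ s≤s (+-monoˡ-≤ P (+-mono-≤ (s≤s⁻¹ r<m) (*-monoˡ-≤ K S≤P))) ⟩
  suc (K + P * K + P)           ≡⟨ expand K P ⟨
  suc K * suc P                 ∎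
  where
  open ≤-Reasoning
  expand : ∀ K P → suc K * suc P ≡ suc (K + P * K + P)
  expand = solve-∀

tableEntry-injective : ∀ {m r r′ S S′ P} → r < m → r′ < m → S ≤ P → S′ ≤ P →
                       tableEntry m r S P ≡ tableEntry m r′ S′ P → r ≡ r′ × S ≡ S′
tableEntry-injective {r = zero}  {zero}   _ _ S≤P S′≤P eq = refl , ∸-cancelˡ-≡ S≤P S′≤P eq
tableEntry-injective {suc K} {zero}  {suc u′} {S} {S′} {P} _ _ _ S′≤P eq rewrite tableEntry-suc K u′ S′≤P =
  ⊥-elim (<⇒≱ (s≤s (m≤n+m P _)) (subst (_≤ P) eq (m∸n≤m P S)))
tableEntry-injective {suc K} {suc u} {zero}   {S} {S′} {P} _ _ S≤P _ eq rewrite tableEntry-suc K u S≤P =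
  ⊥-elim (<⇒≱ (s≤s (m≤n+m P _)) (subst (_≤ P) (sym eq) (m∸n≤m P S′)))
tableEntry-injective {suc (suc k)} {suc u} {suc u′} {S} {S′} {P} r<m r′<m S≤P S′≤P eq
  rewrite tableEntry-suc (suc k) u S≤P | tableEntry-suc (suc k) u′ S′≤P =
  cong suc u≡u′ , *-cancelʳ-≡ S S′ (suc k) (+-cancelˡ-≡ u′ _ _ (trans (cong (_+ S * K) (sym u≡u′)) divmod))
  where
  K = suc k
  divmod : u + S * K ≡ u′ + S′ * K
  divmod = +-cancelʳ-≡ P _ _ (suc-injective eq)
  u≡u′ : u ≡ u′
  u≡u′ = begin
    u                   ≡⟨ m<n⇒m%n≡m (s≤s⁻¹ r<m) ⟨
    u % K               ≡⟨ [m+kn]%n≡m%n u S K ⟨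
    (u + S * K) % K     ≡⟨ cong (_% K) divmod ⟩
    (u′ + S′ * K) % K   ≡⟨ [m+kn]%n≡m%n u′ S′ K ⟩
    u′ % K              ≡⟨ m<n⇒m%n≡m (s≤s⁻¹ r′<m) ⟩
    u′                  ∎
    where open ≡-Reasoning
tableEntry-injective {suc zero} {suc u} {suc u′} (s≤s ()) _ _ _ _

record TableEntryPreimage (m P d : ℕ) : Set where
  constructor preimage
  field
    r          : ℕ
    S          : ℕ
    r<m        : r < m
    S≤P        : S ≤ P
    tableEntry≡ : tableEntry m r S P ≡ d

tableEntry-surjective : ∀ {m P d} → d < m * suc P → TableEntryPreimage m P d
tableEntry-surjective {suc K} {P} {d} d<m[1+P] with d ≤? P
... | yes d≤P = preimage 0 (P ∸ d) z<s (m∸n≤m P d) (m∸[m∸n]≡n d≤P)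
... | no  d≰P = preimage (suc (e % K)) (e / K) (s≤s (m%n<n e K)) S≤P (begin
  tableEntry (suc K) (suc (e % K)) (e / K) P ≡⟨ tableEntry-suc K (e % K) S≤P ⟩
  suc (e % K + e / K * K + P)                ≡⟨ cong (λ x → suc (x + P)) (m≡m%n+[m/n]*n e K) ⟨
  suc (e + P)                                ≡⟨ cong suc (+-comm e P) ⟩
  suc P + e                                  ≡⟨ m+[n∸m]≡n (≰⇒> d≰P) ⟩
  d                                          ∎)
  where
  open ≡-Reasoning
  e = d ∸ suc P
  e<[1+P]K : e < suc P * K
  e<[1+P]K = +-cancelˡ-< (suc P) e (suc P * K)
    (subst₂ _<_ (sym (m+[n∸m]≡n (≰⇒> d≰P))) (trans (*-comm (suc K) (suc P)) (*-suc (suc P) K)) d<m[1+P])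
  instance
    K≢0 : NonZero K
    K≢0 = ≢-nonZero λ { refl → d≰P (s≤s⁻¹ (subst (d <_) (+-identityʳ (suc P)) d<m[1+P])) }
  S≤P : e / K ≤ P
  S≤P = s≤s⁻¹ (m<n*o⇒m/o<n {e} {suc P} {K} e<[1+P]K)

-- Rotations ε^k
[m%n+o]%n≡[m+o]%n : ∀ m o n .{{_ : NonZero n}} → (m % n + o) % n ≡ (m + o) % n
[m%n+o]%n≡[m+o]%n m o n = begin
  (m % n + o) % n              ≡⟨ %-distribˡ-+ (m % n) o n ⟩
  (m % n % n + o % n) % n      ≡⟨ cong (λ x → (x + o % n) % n) (m%n%n≡m%n m n) ⟩
  (m % n + o % n) % n          ≡⟨ %-distribˡ-+ m o n ⟨
  (m + o) % n                  ∎
  where open ≡-Reasoning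

[m+o%n]%n≡[m+o]%n : ∀ m o n .{{_ : NonZero n}} → (m + o % n) % n ≡ (m + o) % n
[m+o%n]%n≡[m+o]%n m o n = begin
  (m + o % n) % n   ≡⟨ cong (_% n) (+-comm m (o % n)) ⟩
  (o % n + m) % n   ≡⟨ [m%n+o]%n≡[m+o]%n o m n ⟩
  (o + m) % n       ≡⟨ cong (_% n) (+-comm o m) ⟩
  (m + o) % n       ∎
  where open ≡-Reasoning

<ᵇ-[k+r]%m : ∀ {k r m} .{{_ : NonZero m}} → 0 < k → k < m → r < m → (r <ᵇ (k + r) % m) ≡ (k <ᵇ m ∸ r)
<ᵇ-[k+r]%m {k} {r} {m} 0<k k<m r<m with k + r <? m
... | yes k+r<m rewrite m<n⇒m%n≡m k+r<m =
  trans (<ᵇ-true (m<n+m r 0<k)) (sym (<ᵇ-true (m+n≤o⇒m≤o∸n (suc k) k+r<m)))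
... | no  k+r≮m = trans (cong (r <ᵇ_) wrapped) (trans (<ᵇ-false (<⇒≯ k+r∸m<r)) (sym (<ᵇ-false k≮m∸r)))
  where
  m≤k+r = ≮⇒≥ k+r≮m
  k+r∸m<r : k + r ∸ m < r
  k+r∸m<r = subst (k + r ∸ m <_) (m+n∸m≡n m r) (∸-monoˡ-< (+-monoˡ-< r k<m) m≤k+r)
  wrapped : (k + r) % m ≡ k + r ∸ m
  wrapped = trans (sym (m≤n⇒[n∸m]%m≡n%m m≤k+r)) (m<n⇒m%n≡m (<-trans k+r∸m<r r<m))
  k≮m∸r : ¬ k < m ∸ r
  k≮m∸r k<m∸r = k+r≮m (subst (k + r <_) (m∸n+n≡m (<⇒≤ r<m)) (+-monoˡ-< r k<m∸r))

module _ {M : ℕ} where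

  private
    m = suc M

  toℕ-rot : ∀ (k i : Fin m) → toℕ (rot k i) ≡ (toℕ k + toℕ i) % m
  toℕ-rot k i = toℕ-fromℕ< (m%n<n (toℕ k + toℕ i) m)

  rot-identityˡ : ∀ (r : Fin m) → rot fzero r ≡ r
  rot-identityˡ r = toℕ-injective (trans (toℕ-rot fzero r) (m<n⇒m%n≡m (toℕ<n r)))

  rot-identityʳ : ∀ (k : Fin m) → rot k fzero ≡ k
  rot-identityʳ k = toℕ-injective (trans (toℕ-rot k fzero) (trans (cong (_% m) (+-identityʳ (toℕ k))) (m<n⇒m%n≡m (toℕ<n k))))

  rot-assoc : ∀ (k i r : Fin m) → rot k (rot i r) ≡ rot (rot k i) r
  rot-assoc k i r = toℕ-injective (begin
    toℕ (rot k (rot i r))                ≡⟨ toℕ-rot k (rot i r) ⟩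
    (toℕ k + toℕ (rot i r)) % m          ≡⟨ cong (λ x → (toℕ k + x) % m) (toℕ-rot i r) ⟩
    (toℕ k + (toℕ i + toℕ r) % m) % m    ≡⟨ [m+o%n]%n≡[m+o]%n (toℕ k) _ m ⟩
    (toℕ k + (toℕ i + toℕ r)) % m        ≡⟨ cong (_% m) (+-assoc (toℕ k) _ _) ⟨
    (toℕ k + toℕ i + toℕ r) % m          ≡⟨ [m%n+o]%n≡[m+o]%n (toℕ k + toℕ i) _ m ⟨
    ((toℕ k + toℕ i) % m + toℕ r) % m    ≡⟨ cong (λ x → (x + toℕ r) % m) (toℕ-rot k i) ⟨
    (toℕ (rot k i) + toℕ r) % m          ≡⟨ toℕ-rot (rot k i) r ⟨
    toℕ (rot (rot k i) r)                ∎)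
    where open ≡-Reasoning

  unrot : Fin m → Fin m → Fin m
  unrot r y = (toℕ y + (m ∸ toℕ r)) mod m

  private
    shift-back : ∀ {a b c} → b + c ≡ m → a < m → ((a + b) % m + c) % m ≡ a
    shift-back {a} {b} {c} b+c≡m a<m = begin
      ((a + b) % m + c) % m   ≡⟨ [m%n+o]%n≡[m+o]%n (a + b) c m ⟩
      (a + b + c) % m         ≡⟨ cong (_% m) (trans (+-assoc a b c) (cong (a +_) b+c≡m)) ⟩
      (a + m) % m             ≡⟨ [m+n]%n≡m%n a m ⟩
      a % m                   ≡⟨ m<n⇒m%n≡m a<m ⟩
      a                       ∎
      where open ≡-Reasoning

  toℕ-unrot : ∀ (r y : Fin m) → toℕ (unrot r y) ≡ (toℕ y + (m ∸ toℕ r)) % m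
  toℕ-unrot r y = toℕ-fromℕ< (m%n<n (toℕ y + (m ∸ toℕ r)) m)

  unrot-rot : ∀ (r k : Fin m) → unrot r (rot k r) ≡ k
  unrot-rot r k = toℕ-injective (begin
    toℕ (unrot r (rot k r))                    ≡⟨ toℕ-unrot r (rot k r) ⟩
    (toℕ (rot k r) + (m ∸ toℕ r)) % m          ≡⟨ cong (λ x → (x + (m ∸ toℕ r)) % m) (toℕ-rot k r) ⟩
    ((toℕ k + toℕ r) % m + (m ∸ toℕ r)) % m    ≡⟨ shift-back (m+[n∸m]≡n (<⇒≤ (toℕ<n r))) (toℕ<n k) ⟩
    toℕ k                                      ∎)
    where open ≡-Reasoning

  rot-unrot : ∀ (r y : Fin m) → rot (unrot r y) r ≡ y
  rot-unrot r y = toℕ-injective (begin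
    toℕ (rot (unrot r y) r)                    ≡⟨ toℕ-rot (unrot r y) r ⟩
    (toℕ (unrot r y) + toℕ r) % m              ≡⟨ cong (λ x → (x + toℕ r) % m) (toℕ-unrot r y) ⟩
    ((toℕ y + (m ∸ toℕ r)) % m + toℕ r) % m    ≡⟨ shift-back (m∸n+n≡m (<⇒≤ (toℕ<n r))) (toℕ<n y) ⟩
    toℕ y                                      ∎)
    where open ≡-Reasoning

-- Elements of G(m,1,n) and their inversion tables
extendℕ : ∀ {n} → (Fin n → ℕ) → ℕ → ℕ
extendℕ {n} f q with q <? n
... | yes q<n = f (fromℕ< q<n)
... | no  _   = 0

extendℕ-fromℕ< : ∀ {n} (f : Fin n → ℕ) {q} (q<n : q < n) → extendℕ f q ≡ f (fromℕ< q<n)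
extendℕ-fromℕ< {n} f {q} q<n with q <? n
... | yes _   = refl
... | no  q≮n = ⊥-elim (q≮n q<n)

extendℕ-toℕ : ∀ {n} (f : Fin n → ℕ) (i : Fin n) → extendℕ f (toℕ i) ≡ f i
extendℕ-toℕ f i = trans (extendℕ-fromℕ< f (toℕ<n i)) (cong f (fromℕ<-toℕ i (toℕ<n i)))

module _ {m n : ℕ} (a x : Fin m) (b c : Fin n) where

  isNeg-sameIndex : toℕ b ≡ toℕ c → isNeg ((a , b) , (x , c)) ≡ not (toℕ a <ᵇ toℕ x)
  isNeg-sameIndex b≡c
    rewrite ≡ᵇ-true b≡c | <ᵇ-false (<-irrefl (sym b≡c)) | <ᵇ-false (<-irrefl b≡c) = cong not (∨-identityʳ _)

  isNeg-lowerIndex : toℕ c < toℕ b → isNeg ((a , b) , (x , c)) ≡ not (isZero a)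
  isNeg-lowerIndex c<b
    rewrite ≡ᵇ-false (≢-sym (<⇒≢ c<b)) | <ᵇ-true c<b | <ᵇ-false (<⇒≯ c<b) = cong not (∨-identityʳ _)

  isNeg-higherIndex : toℕ b < toℕ c → isNeg ((a , b) , (x , c)) ≡ isZero x
  isNeg-higherIndex b<c
    rewrite ≡ᵇ-false (<⇒≢ b<c) | <ᵇ-false (<⇒≯ b<c) | <ᵇ-true b<c = not-involutive _

module Decomposition {M n : ℕ} (w : G (suc M) n) where

  private
    m = suc M

  colour : Fin n → Fin m
  colour j = proj₁ (fun w (fzero , j))

  perm : Fin n → Fin n
  perm j = proj₂ (fun w (fzero , j))

  fun-decomposition : ∀ k j → fun w (k , j) ≡ (rot k (colour j) , perm j)
  fun-decomposition k j = trans (cong (λ k → fun w (k , j)) (sym (rot-identityʳ k))) (equiv w k (fzero , j))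

  perm-injective : ∀ {i j} → perm i ≡ perm j → i ≡ j
  perm-injective {i} {j} eq = cong proj₂ (proj₁ (bij w) (begin
    fun w (unrot (colour i) (colour j) , i)                  ≡⟨ fun-decomposition _ i ⟩
    (rot (unrot (colour i) (colour j)) (colour i) , perm i)  ≡⟨ cong₂ _,_ (rot-unrot (colour i) (colour j)) eq ⟩
    (colour j , perm j)                                      ≡⟨ cong (_, perm j) (rot-identityˡ (colour j)) ⟨
    (rot fzero (colour j) , perm j)                          ≡⟨ fun-decomposition fzero j ⟨
    fun w (fzero , j)                                        ∎))
    where open ≡-Reasoning

  β : ℕ → ℕ
  β = extendℕ (toℕ ∘ perm)

  β-toℕ : ∀ j → β (toℕ j) ≡ toℕ (perm j)
  β-toℕ = extendℕ-toℕ (toℕ ∘ perm)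

  β-isPermutation : IsPermutation n β
  β-isPermutation = record { bounded = bd ; injective = inj ; surjective = surj }
    where
    bd : ∀ {j} → j < n → β j < n
    bd j<n = subst (_< n) (sym (extendℕ-fromℕ< (toℕ ∘ perm) j<n)) (toℕ<n _)
    inj : ∀ {i j} → i < n → j < n → β i ≡ β j → i ≡ j
    inj {i} {j} i<n j<n βi≡βj = begin
      i                  ≡⟨ toℕ-fromℕ< i<n ⟨
      toℕ (fromℕ< i<n)   ≡⟨ cong toℕ (perm-injective (toℕ-injective same-perm)) ⟩
      toℕ (fromℕ< j<n)   ≡⟨ toℕ-fromℕ< j<n ⟩
      j                  ∎
      where
      open ≡-Reasoning
      same-perm : toℕ (perm (fromℕ< i<n)) ≡ toℕ (perm (fromℕ< j<n))
      same-perm = trans (sym (extendℕ-fromℕ< (toℕ ∘ perm) i<n)) (trans βi≡βj (extendℕ-fromℕ< (toℕ ∘ perm) j<n))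
    surj : ∀ {y} → y < n → ∃[ j ] j < n × β j ≡ y
    surj {y} y<n = toℕ j , toℕ<n j , (begin
      β (toℕ j)              ≡⟨ β-toℕ j ⟩
      toℕ (perm j)           ≡⟨ cong (toℕ ∘ proj₂) (trans (sym (fun-decomposition (proj₁ x) j)) (proj₂ source refl)) ⟩
      toℕ (fromℕ< y<n)       ≡⟨ toℕ-fromℕ< y<n ⟩
      y                      ∎)
      where
      open ≡-Reasoning
      source = proj₂ (bij w) (fzero , fromℕ< y<n)
      x = proj₁ source
      j = proj₂ x

  isNegAt : Root m n → ℕ
  isNegAt = fromBool ∘ isNeg ∘ actRoot w

  module _ (p : Fin n) where

    private
      r = toℕ (colour p)
      P = toℕ p
      S = lehmerCode β P

    isNegAt-decomposition : ∀ k j → isNegAt ((fzero , p) , (k , j)) ≡ fromBool (isNeg ((colour p , perm p) , (rot k (colour j) , perm j)))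
    isNegAt-decomposition k j = cong (λ x → fromBool (isNeg ((colour p , perm p) , x))) (fun-decomposition k j)

    sameIndexRoot : Fin m → Root m n
    sameIndexRoot k = ((fzero , p) , (k , p))

    sameIndexRoots : List (Root m n)
    sameIndexRoots = map sameIndexRoot (filterᵇ (not ∘ isZero) (allFin m))

    negatives-sameIndex : sumMap isNegAt sameIndexRoots ≡ r
    negatives-sameIndex = begin
      sumMap isNegAt (map sameIndexRoot (filterᵇ (not ∘ isZero) (allFin m)))
        ≡⟨ sumMap-map isNegAt sameIndexRoot (filterᵇ (not ∘ isZero) (allFin m)) ⟩
      sumMap (isNegAt ∘ sameIndexRoot) (filterᵇ (not ∘ isZero) (allFin m))
        ≡⟨ sumMap-filterᵇ-allFin m (not ∘ isZero) _ wrapsAround nonzero atZero ⟩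
      count m (not ∘ (_<ᵇ m ∸ r))
        ≡⟨ count-not m (_<ᵇ m ∸ r) ⟩
      m ∸ count m (_<ᵇ m ∸ r)
        ≡⟨ cong (m ∸_) (count-<ᵇ-permutation id-isPermutation (m∸n≤m m r)) ⟩
      m ∸ (m ∸ r)
        ≡⟨ m∸[m∸n]≡n (<⇒≤ (toℕ<n (colour p))) ⟩
      r ∎
      where
      open ≡-Reasoning
      wrapsAround : ℕ → ℕ
      wrapsAround q = fromBool (not (q <ᵇ m ∸ r))
      nonzero : ∀ k → not (isZero k) ≡ true → isNegAt (sameIndexRoot k) ≡ wrapsAround (toℕ k)
      nonzero fzero    ()
      nonzero (fsuc k) _ = begin
        isNegAt (sameIndexRoot (fsuc k))
          ≡⟨ isNegAt-decomposition (fsuc k) p ⟩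
        fromBool (isNeg ((colour p , perm p) , (rot (fsuc k) (colour p) , perm p)))
          ≡⟨ cong fromBool (isNeg-sameIndex (colour p) (rot (fsuc k) (colour p)) (perm p) (perm p) refl) ⟩
        fromBool (not (r <ᵇ toℕ (rot (fsuc k) (colour p))))
          ≡⟨ cong (λ x → fromBool (not (r <ᵇ x))) (toℕ-rot (fsuc k) (colour p)) ⟩
        fromBool (not (r <ᵇ (toℕ (fsuc k) + r) % m))
          ≡⟨ cong (fromBool ∘ not) (<ᵇ-[k+r]%m z<s (toℕ<n (fsuc k)) (toℕ<n (colour p))) ⟩
        wrapsAround (toℕ (fsuc k)) ∎
      atZero : ∀ k → not (isZero k) ≡ false → wrapsAround (toℕ k) ≡ 0
      atZero fzero    _  = cong (fromBool ∘ not) (<ᵇ-true (m<n⇒0<n∸m (toℕ<n (colour p))))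
      atZero (fsuc k) ()

    lowerIndexRoot : Fin n → Fin m → Root m n
    lowerIndexRoot j k = ((fzero , p) , (k , j))

    contribution : ℕ → ℕ
    contribution q = if β q <ᵇ β P then colourWeight m r else 1

    contribution-< : ∀ j → toℕ (perm j) < toℕ (perm p) → contribution (toℕ j) ≡ colourWeight m r
    contribution-< j πj<πp rewrite β-toℕ j | β-toℕ p | <ᵇ-true πj<πp = refl

    contribution-> : ∀ j → toℕ (perm p) < toℕ (perm j) → contribution (toℕ j) ≡ 1
    contribution-> j πp<πj rewrite β-toℕ j | β-toℕ p | <ᵇ-false (<⇒≯ πp<πj) = refl

    negatives-lowerIndex : ∀ j → toℕ j < P → sumMap isNegAt (map (lowerIndexRoot j) (allFin m)) ≡ contribution (toℕ j)
    negatives-lowerIndex j j<P with <-cmp (toℕ (perm j)) (toℕ (perm p))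
    ... | tri< πj<πp _ _ = begin
      sumMap isNegAt (map (lowerIndexRoot j) (allFin m))   ≡⟨ sumMap-map isNegAt (lowerIndexRoot j) (allFin m) ⟩
      sumMap (isNegAt ∘ lowerIndexRoot j) (allFin m)       ≡⟨ sumMap-tabulate m (λ k → k) _ _ constant ⟩
      sumBelow m (const c)                                 ≡⟨ sumBelow-const m c ⟩
      m * c                                                ≡⟨ colourWeight-fromBool m r ⟩
      colourWeight m r                                     ≡⟨ contribution-< j πj<πp ⟨
      contribution (toℕ j)                                 ∎
      where
      open ≡-Reasoning
      c = fromBool (not (isZero (colour p)))
      constant : ∀ k → isNegAt (lowerIndexRoot j k) ≡ c
      constant k = trans (isNegAt-decomposition k j) (cong fromBool (isNeg-lowerIndex (colour p) (rot k (colour j)) (perm p) (perm j) πj<πp))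
    ... | tri≈ _ πj≡πp _ = ⊥-elim (<-irrefl (cong toℕ (perm-injective (toℕ-injective πj≡πp))) j<P)
    ... | tri> _ _ πp<πj = begin
      sumMap isNegAt (map (lowerIndexRoot j) (allFin m))   ≡⟨ sumMap-map isNegAt (lowerIndexRoot j) (allFin m) ⟩
      sumMap (isNegAt ∘ lowerIndexRoot j) (allFin m)       ≡⟨ sumMap-tabulate m (λ k → k) _ _ hitsZero ⟩
      count m (_≡ᵇ toℕ u)                                  ≡⟨ count-≡ᵇ (toℕ<n u) ⟩
      1                                                    ≡⟨ contribution-> j πp<πj ⟨
      contribution (toℕ j)                                 ∎
      where
      open ≡-Reasoning
      u = unrot (colour j) fzero
      hitsZero : ∀ k → isNegAt (lowerIndexRoot j k) ≡ fromBool (toℕ k ≡ᵇ toℕ u)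
      hitsZero k = trans (isNegAt-decomposition k j) (cong fromBool (trans
        (isNeg-higherIndex (colour p) (rot k (colour j)) (perm p) (perm j) πp<πj)
        (≡ᵇ-cong-⇔ (λ eq → cong toℕ (trans (sym (unrot-rot (colour j) k)) (cong (unrot (colour j)) (toℕ-injective eq))))
                   (λ eq → cong toℕ (trans (cong (λ k → rot k (colour j)) (toℕ-injective eq)) (rot-unrot (colour j) fzero))))))

    lowerIndexRoots : List (Root m n)
    lowerIndexRoots = concatMap (λ j → map (lowerIndexRoot j) (allFin m)) (filterᵇ (λ j → toℕ j <ᵇ P) (allFin n))

    negatives-lowerIndices : sumMap isNegAt lowerIndexRoots ≡ colourWeight m r * S + (P ∸ S)
    negatives-lowerIndices = begin
      sumMap isNegAt (concatMap roots (filterᵇ below (allFin n)))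
        ≡⟨ sumMap-concatMap isNegAt roots (filterᵇ below (allFin n)) ⟩
      sumMap (sumMap isNegAt ∘ roots) (filterᵇ below (allFin n))
        ≡⟨ sumMap-filterᵇ-allFin n below _ _ kept dropped ⟩
      sumBelow n (λ q → if q <ᵇ P then contribution q else 0)
        ≡⟨ sumBelow-truncate contribution (<⇒≤ (toℕ<n p)) ⟩
      sumBelow P contribution
        ≡⟨ sumBelow-if P (λ q → β q <ᵇ β P) (colourWeight m r) ⟩
      colourWeight m r * S + (P ∸ S) ∎
      where
      open ≡-Reasoning
      roots : Fin n → List (Root m n)
      roots j = map (lowerIndexRoot j) (allFin m)
      below : Fin n → Bool
      below j = toℕ j <ᵇ P
      kept : ∀ j → below j ≡ true → sumMap isNegAt (roots j) ≡ (if toℕ j <ᵇ P then contribution (toℕ j) else 0)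
      kept j j<P = trans (negatives-lowerIndex j (<ᵇ≡true⇒< j<P)) (cong (if_then contribution (toℕ j) else 0) (sym j<P))
      dropped : ∀ j → below j ≡ false → (if toℕ j <ᵇ P then contribution (toℕ j) else 0) ≡ 0
      dropped j j≮P = cong (if_then contribution (toℕ j) else 0) j≮P

    negatives : length (filterᵇ isNeg (map (actRoot w) (Δ p))) ≡ tableEntry m r S P
    negatives = begin
      length (filterᵇ isNeg (map (actRoot w) (Δ p)))              ≡⟨ length-filterᵇ isNeg (map (actRoot w) (Δ p)) ⟩
      sumMap (fromBool ∘ isNeg) (map (actRoot w) (Δ p))           ≡⟨ sumMap-map (fromBool ∘ isNeg) (actRoot w) (Δ p) ⟩
      sumMap isNegAt (sameIndexRoots ++ lowerIndexRoots)           ≡⟨ sumMap-++ isNegAt sameIndexRoots lowerIndexRoots ⟩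
      sumMap isNegAt sameIndexRoots + sumMap isNegAt lowerIndexRoots ≡⟨ cong₂ _+_ negatives-sameIndex negatives-lowerIndices ⟩
      tableEntry m r S P                                           ∎
      where open ≡-Reasoning

module _ {M n : ℕ} (c : Fin n → Fin (suc M)) {γ : ℕ → ℕ} (π : IsPermutation n γ) where

  private
    m = suc M

  γᶠ : Fin n → Fin n
  γᶠ j = fromℕ< (IsPermutation.bounded π (toℕ<n j))

  toℕ-γᶠ : ∀ j → toℕ (γᶠ j) ≡ γ (toℕ j)
  toℕ-γᶠ j = toℕ-fromℕ< _

  colouredPermutation : G m n
  colouredPermutation = record { fun = f ; bij = f-injective , f-surjective ; equiv = f-equiv }
    where
    f : Point m n → Point m n
    f (k , j) = (rot k (c j) , γᶠ j)
    f-injective : ∀ {x y} → f x ≡ f y → x ≡ y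
    f-injective {k , i} {k′ , j} eq with toℕ-injective {i = i} {j = j}
      (IsPermutation.injective π (toℕ<n i) (toℕ<n j) (trans (sym (toℕ-γᶠ i)) (trans (cong (toℕ ∘ proj₂) eq) (toℕ-γᶠ j))))
    ... | refl = cong (_, i) (trans (sym (unrot-rot (c i) k)) (trans (cong (unrot (c i) ∘ proj₁) eq) (unrot-rot (c i) k′)))
    f-surjective : ∀ y → ∃[ x ] (∀ {z} → z ≡ x → f z ≡ y)
    f-surjective (l , b) with IsPermutation.surjective π (toℕ<n b)
    ... | q , q<n , γq≡b = (unrot (c j) l , j) , λ { refl → cong₂ _,_ (rot-unrot (c j) l) (toℕ-injective
            (trans (toℕ-γᶠ j) (trans (cong γ (toℕ-fromℕ< q<n)) γq≡b))) }
      where j = fromℕ< q<n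
    f-equiv : ∀ k x → f (act k x) ≡ act k (f x)
    f-equiv k (i , j) = cong (_, γᶠ j) (sym (rot-assoc k i (c j)))

  open Decomposition colouredPermutation

  colour-colouredPermutation : ∀ j → colour j ≡ c j
  colour-colouredPermutation j = rot-identityˡ (c j)

  β-colouredPermutation : ∀ {q} → q < n → β q ≡ γ q
  β-colouredPermutation {q} q<n = trans (extendℕ-fromℕ< (toℕ ∘ perm) q<n) (trans (toℕ-γᶠ (fromℕ< q<n)) (cong γ (toℕ-fromℕ< q<n)))

module InversionTable {M n : ℕ} where

  private
    m = suc M

  open Decomposition

  entry : G m n → Fin n → ℕ
  entry w p = tableEntry m (toℕ (colour w p)) (lehmerCode (β w) (toℕ p)) (toℕ p)

  lookup-Inv-opposite : ∀ (w : G m n) p → lookup (Inv w) (opposite p) ≡ entry w p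
  lookup-Inv-opposite w p = begin
    lookup (Inv w) (opposite p)   ≡⟨ lookup∘tabulate (λ i → inv i w) (opposite p) ⟩
    inv (opposite p) w                              ≡⟨ cong (λ q → length (filterᵇ isNeg (map (actRoot w) (Δ q)))) (opposite-involutive p) ⟩
    length (filterᵇ isNeg (map (actRoot w) (Δ p)))  ≡⟨ negatives w p ⟩
    entry w p                                       ∎
    where open ≡-Reasoning

  suc-toℕ-opposite : ∀ (i : Fin n) → suc (toℕ (opposite i)) ≡ n ∸ toℕ i
  suc-toℕ-opposite i = trans (cong suc (opposite-prop i)) (sym (+-∸-assoc 1 (toℕ<n i)))

  Inv-bounded : ∀ (w : G m n) → InT m n (Inv w)
  Inv-bounded w i = begin-strict
    lookup (Inv w) i                           ≡⟨ cong (lookup (Inv w)) (opposite-involutive i) ⟨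
    lookup (Inv w) (opposite (opposite i))     ≡⟨ lookup-Inv-opposite w (opposite i) ⟩
    entry w (opposite i)                       <⟨ tableEntry-< (toℕ<n (colour w (opposite i))) (lehmerCode-≤ (β w) _) ⟩
    m * suc (toℕ (opposite i))                 ≡⟨ cong (m *_) (suc-toℕ-opposite i) ⟩
    m * (n ∸ toℕ i)                            ∎
    where open ≤-Reasoning

  Inv-injective : ∀ (w w′ : G m n) → Inv w ≡ Inv w′ → ∀ x → fun w x ≡ fun w′ x
  Inv-injective w w′ Inv≡ (k , j) = begin
    fun w (k , j)                      ≡⟨ fun-decomposition w k j ⟩
    (rot k (colour w j) , perm w j)    ≡⟨ cong₂ (λ c π → (rot k c , π)) same-colour same-perm ⟩
    (rot k (colour w′ j) , perm w′ j)  ≡⟨ fun-decomposition w′ k j ⟨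
    fun w′ (k , j)                     ∎
    where
    open ≡-Reasoning
    same-entry : ∀ p → entry w p ≡ entry w′ p
    same-entry p = trans (sym (lookup-Inv-opposite w p)) (trans (cong (λ v → lookup v (opposite p)) Inv≡) (lookup-Inv-opposite w′ p))
    same-digits : ∀ p → toℕ (colour w p) ≡ toℕ (colour w′ p) × lehmerCode (β w) (toℕ p) ≡ lehmerCode (β w′) (toℕ p)
    same-digits p = tableEntry-injective (toℕ<n (colour w p)) (toℕ<n (colour w′ p))
                                         (lehmerCode-≤ (β w) (toℕ p)) (lehmerCode-≤ (β w′) (toℕ p)) (same-entry p)
    same-colour : colour w j ≡ colour w′ j
    same-colour = toℕ-injective (proj₁ (same-digits j))
    same-code : ∀ q → q < n → lehmerCode (β w) q ≡ lehmerCode (β w′) q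
    same-code q q<n = subst (λ q → lehmerCode (β w) q ≡ lehmerCode (β w′) q) (toℕ-fromℕ< q<n) (proj₂ (same-digits (fromℕ< q<n)))
    same-perm : perm w j ≡ perm w′ j
    same-perm = toℕ-injective (begin
      toℕ (perm w j)    ≡⟨ β-toℕ w j ⟨
      β w (toℕ j)       ≡⟨ lehmerCode-injective n (β-isPermutation w) (β-isPermutation w′) same-code (toℕ j) (toℕ<n j) ⟩
      β w′ (toℕ j)      ≡⟨ β-toℕ w′ j ⟩
      toℕ (perm w′ j)   ∎)

  Inv-surjective : ∀ (a : Vec ℕ n) → InT m n a → Σ (G m n) (λ w → Inv w ≡ a)
  Inv-surjective a a∈T = w , trans (tabulate-cong matches) (tabulate∘lookup a)
    where
    open ≡-Reasoning
    digits : ∀ p → TableEntryPreimage m (toℕ p) (lookup a (opposite p))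
    digits p = tableEntry-surjective (subst (λ k → lookup a (opposite p) < m * k) size (a∈T (opposite p)))
      where
      size : n ∸ toℕ (opposite p) ≡ suc (toℕ p)
      size = trans (sym (suc-toℕ-opposite (opposite p))) (cong (suc ∘ toℕ) (opposite-involutive p))
    open TableEntryPreimage
    code : ℕ → ℕ
    code = extendℕ (S ∘ digits)
    code-isLehmerCode : IsLehmerCode n code
    code-isLehmerCode q q<n = subst₂ _≤_ (sym (extendℕ-fromℕ< (S ∘ digits) q<n)) (toℕ-fromℕ< q<n) (S≤P (digits (fromℕ< q<n)))
    colours : Fin n → Fin m
    colours p = fromℕ< (r<m (digits p))
    γ = fromLehmerCode code n
    γ-isPermutation = fromLehmerCode-isPermutation n code-isLehmerCode
    w = colouredPermutation colours γ-isPermutation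
    entry-w : ∀ p → entry w p ≡ lookup a (opposite p)
    entry-w p = begin
      entry w p                                           ≡⟨ cong₂ (λ r S → tableEntry m r S (toℕ p)) colour-w code-w ⟩
      tableEntry m (r (digits p)) (S (digits p)) (toℕ p)  ≡⟨ tableEntry≡ (digits p) ⟩
      lookup a (opposite p)                               ∎
      where
      colour-w : toℕ (colour w p) ≡ r (digits p)
      colour-w = trans (cong toℕ (colour-colouredPermutation colours γ-isPermutation p)) (toℕ-fromℕ< _)
      code-w : lehmerCode (β w) (toℕ p) ≡ S (digits p)
      code-w = begin
        lehmerCode (β w) (toℕ p) ≡⟨ lehmerCode-cong (toℕ p) (λ q q≤p →
                                      β-colouredPermutation colours γ-isPermutation (≤-<-trans q≤p (toℕ<n p))) ⟩
        lehmerCode γ (toℕ p)     ≡⟨ lehmerCode-fromLehmerCode n code-isLehmerCode (toℕ p) (toℕ<n p) ⟩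
        code (toℕ p)             ≡⟨ extendℕ-toℕ (S ∘ digits) p ⟩
        S (digits p)             ∎
    matches : ∀ i → inv i w ≡ lookup a i
    matches i = begin
      inv i w                                 ≡⟨ lookup∘tabulate (λ i → inv i w) i ⟨
      lookup (Inv w) i                        ≡⟨ cong (lookup (Inv w)) (opposite-involutive i) ⟨
      lookup (Inv w) (opposite (opposite i))  ≡⟨ lookup-Inv-opposite w (opposite i) ⟩
      entry w (opposite i)                    ≡⟨ entry-w (opposite i) ⟩
      lookup a (opposite (opposite i))        ≡⟨ cong (lookup a) (opposite-involutive i) ⟩
      lookup a i                              ∎

proposition4p10 : ∀ (m n : ℕ) → 2 ≤ m → 1 ≤ n →
    ((w : G m n) → InT m n (Inv w))
    × ((w w′ : G m n) → Inv w ≡ Inv w′ → ∀ (x : Point m n) → fun w x ≡ fun w′ x)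
    × ((a : Vec ℕ n) → InT m n a → Σ (G m n) (λ w → Inv w ≡ a))
-- The hypotheses are used only to exclude m = 0.
proposition4p10 zero    n () _
proposition4p10 (suc M) n _  _ = Inv-bounded , Inv-injective , Inv-surjective
  where open InversionTable {M} {n}
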